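{- Let $T$ be a type and $\Gamma$ a typing context of $\lambda_{CA}$. (1) If $\Gamma\vdash\mathbf{u}\,\mathbf{v}:T$, then there exist natural numbers $\alpha,\beta$, a unit type $U$ and types $T_1,\dots,T_\alpha$ such that $\Gamma\vdash\mathbf{u}:\sum_{i=1}^\alpha(U\to T_i)$, $\Gamma\vdash\mathbf{v}:\beta.U$ and $\sum_{i=1}^\alpha(\beta.T_i)\equiv T$. (2) If $\Gamma\vdash\lambda x{:}U.\mathbf{t}:T$, then there is a type $R$ with $\Gamma,x:U\vdash\mathbf{t}:R$ and $U\to R\equiv T$. (3) If $\Gamma\vdash\mathbf{u}+\mathbf{v}:T$, then there are types $R,S$ with $\Gamma\vdash\mathbf{u}:R$, $\Gamma\vdash\mathbf{v}:S$ and $R+S\equiv T$. (4) If $\Gamma\vdash\alpha.\mathbf{u}:T$ for a nonnegative real $\alpha$, then there is a type $R$ with $\Gamma\vdash\mathbf{u}:R$ and $\lfloor\alpha\rfloor.R\equiv T$. (5) If $\Gamma\vdash\Lambda X.\mathbf{t}:T$, then there is a type $R$ with $\Gamma\vdash\mathbf{t}:R$, $\forall X.R\equiv T$ and $X\notin FV(\Gamma)$. (6) If $\Gamma\vdash\mathbf{t}@U:T$ for a unit type $U$, then there is a type $V$ with $\Gamma\vdash\mathbf{t}:\forall X.V$ and $V[U/X]\equiv T$.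
   Context: The calculus $\lambda_{CA}$. Unit types: $U ::= X \mid U\to T \mid \forall X.U$; general types: $T ::= U \mid T+T \mid \bar 0$. Terms: $\mathbf{t} ::= \mathbf{b} \mid \mathbf{t}\,\mathbf{t} \mid \mathbf{t}@U \mid \mathbf{0} \mid \alpha.\mathbf{t} \mid \mathbf{t}+\mathbf{t}$, basis terms $\mathbf{b} ::= x \mid \lambda x{:}U.\mathbf{t} \mid \Lambda X.\mathbf{t}$, with scalars $\alpha$ nonnegative reals. For a natural $n$, $n.T$ denotes $T+\dots+T$ ($n$ times), $0.T=\bar 0$, $\sum_{i=1}^0T_i=\bar0$. Type equivalence $\equiv$ is the least congruence with $T+\bar0\equiv T$, $T+R\equiv R+T$, $T+(R+S)\equiv(T+R)+S$. Contexts assign unit types to term variables. Typing rules: (ax) $\Gamma,x:U\vdash x:U$; (ax$_{\bar0}$) $\Gamma\vdash\mathbf{0}:\bar0$; ($\to_E$) from $\Gamma\vdash\mathbf{t}:\sum_{i=1}^{\alpha}(U\to T_i)$ and $\Gamma\vdash\mathbf{r}:\beta.U$ ($\alpha,\beta$ naturals) infer $\Gamma\vdash\mathbf{t}\,\mathbf{r}:\sum_{i=1}^\alpha(\beta.T_i)$; ($\to_I$) from $\Gamma,x:U\vdash\mathbf{t}:T$ infer $\Gamma\vdash\lambda x{:}U.\mathbf{t}:U\to T$; ($\forall_E$) from $\Gamma\vdash\mathbf{t}:\forall X.U$ infer $\Gamma\vdash\mathbf{t}@V:U[V/X]$; ($\forall_I$) from $\Gamma\vdash\mathbf{t}:U$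 and $X\notin FV(\Gamma)$ infer $\Gamma\vdash\Lambda X.\mathbf{t}:\forall X.U$; (+I) from $\Gamma\vdash\mathbf{t}:T$ and $\Gamma\vdash\mathbf{r}:R$ infer $\Gamma\vdash\mathbf{t}+\mathbf{r}:T+R$; (sI) from $\Gamma\vdash\mathbf{t}:T$ infer $\Gamma\vdash\alpha.\mathbf{t}:\lfloor\alpha\rfloor.T$; (Eq) from $\Gamma\vdash\mathbf{t}:T$ and $T\equiv R$ infer $\Gamma\vdash\mathbf{t}:R$. -}

module Defs where

open import Data.Nat using (ℕ; zero; suc; _≡ᵇ_; _⊔_)
open import Data.Bool using (Bool; true; false; if_then_else_; not)
open import Data.Fin using (Fin)
import Data.Fin as Fin
open import Data.List using (List; []; _∷_; _++_; filterᵇ; concatMap; foldr)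
open import Data.Bool.ListAction using (any)
open import Data.List.Membership.Propositional using (_∈_)
open import Data.Product using (_×_; _,_)
open import Relation.Nullary using (¬_)
open import Relation.Binary.PropositionalEquality using (_≡_)

TyVar : Set
TyVar = ℕ

TmVar : Set
TmVar = ℕ

mutual
  data UType : Set where
    tvar : TyVar → UType
    _⇒_  : UType → Type → UType
    ∀'   : TyVar → UType → UType

  data Type : Set where
    unit : UType → Type
    _⊕_  : Type → Type → Type
    𝟘    : Type

infixr 7 _⇒_
infixl 6 _⊕_

sumT : (n : ℕ) → (Fin n → Type) → Type
sumT zero T = 𝟘
sumT (suc zero) T = T Fin.zero
sumT (suc (suc n)) T = T Fin.zero ⊕ sumT (suc n) (λ i → T (Fin.suc i))

_·_ : ℕ → Type → Type
n · T = sumT n (λ _ → T)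

infixr 8 _·_

mutual
  fvU : UType → List TyVar
  fvU (tvar X) = X ∷ []
  fvU (U ⇒ T) = fvU U ++ fvT T
  fvU (∀' X U) = filterᵇ (λ z → not (z ≡ᵇ X)) (fvU U)

  fvT : Type → List TyVar
  fvT (unit U) = fvU U
  fvT (T ⊕ R) = fvT T ++ fvT R
  fvT 𝟘 = []

-- Capture-avoiding (simultaneous) substitution of unit types for type variables.
-- A bound variable is renamed (to a fresh name) only when capture would occur.
Subst : Set
Subst = TyVar → UType

_[_↦_] : Subst → TyVar → UType → Subst
(σ [ Y ↦ V ]) z = if z ≡ᵇ Y then V else σ z

mutual
  substU : Subst → UType → UType
  substU σ (tvar X) = σ X
  substU σ (U ⇒ T) = substU σ U ⇒ substT σ T
  substU σ (∀' Y U) =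
    let cs = concatMap (λ z → fvU (σ z)) (fvU (∀' Y U))
        Z  = if any (λ z → z ≡ᵇ Y) cs then suc (foldr _⊔_ 0 cs) else Y
    in ∀' Z (substU (σ [ Y ↦ tvar Z ]) U)

  substT : Subst → Type → Type
  substT σ (unit U) = unit (substU σ U)
  substT σ (T ⊕ R) = substT σ T ⊕ substT σ R
  substT σ 𝟘 = 𝟘

_[_/_] : UType → UType → TyVar → UType
U [ V / X ] = substU (tvar [ X ↦ V ]) U

mutual
  data _≈U_ : UType → UType → Set where
    ≈U-refl  : ∀ {U} → U ≈U U
    ≈U-sym   : ∀ {U V} → U ≈U V → V ≈U U
    ≈U-trans : ∀ {U V W} → U ≈U V → V ≈U W → U ≈U W
    ≈U-⇒     : ∀ {U U' T T'} → U ≈U U' → T ≈ T' → (U ⇒ T) ≈U (U' ⇒ T')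
    ≈U-∀     : ∀ {X U U'} → U ≈U U' → ∀' X U ≈U ∀' X U'

  data _≈_ : Type → Type → Set where
    ≈-refl   : ∀ {T} → T ≈ T
    ≈-sym    : ∀ {T R} → T ≈ R → R ≈ T
    ≈-trans  : ∀ {T R S} → T ≈ R → R ≈ S → T ≈ S
    ≈-unit   : ∀ {U V} → U ≈U V → unit U ≈ unit V
    ≈-⊕      : ∀ {T T' R R'} → T ≈ T' → R ≈ R' → (T ⊕ R) ≈ (T' ⊕ R')
    ≈-neutr  : ∀ {T} → (T ⊕ 𝟘) ≈ T
    ≈-comm   : ∀ {T R} → (T ⊕ R) ≈ (R ⊕ T)
    ≈-assoc  : ∀ {T R S} → (T ⊕ (R ⊕ S)) ≈ ((T ⊕ R) ⊕ S)

infix 4 _≈U_ _≈_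

-- Contexts: lists of assignments of unit types to term variables; Γ , x : U is
-- (x , U) ∷ Γ (the most recent binding of x is the visible one).
Ctx : Set
Ctx = List (TmVar × UType)

data Lookup : Ctx → TmVar → UType → Set where
  here  : ∀ {Γ x U} → Lookup ((x , U) ∷ Γ) x U
  there : ∀ {Γ x y U V} → ¬ (x ≡ y) → Lookup Γ x U → Lookup ((y , V) ∷ Γ) x U

fvCtx : Ctx → List TyVar
fvCtx [] = []
fvCtx ((x , U) ∷ Γ) = fvU U ++ fvCtx Γ

-- The calculus, parametrised by the scalar set (nonnegative reals in the paper)
-- together with its floor function ⌊_⌋ to ℕ.
module λCA (Scalar : Set) (⌊_⌋ : Scalar → ℕ) where

  data Term : Set where
    var  : TmVar → Term
    lam  : TmVar → UType → Term → Term
    Lam  : TyVar → Term → Term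
    _$_  : Term → Term → Term
    _＠_  : Term → UType → Term
    𝟎    : Term
    _∙_  : Scalar → Term → Term
    _+_  : Term → Term → Term

  infix 4 _⊢_∶_
  data _⊢_∶_ : Ctx → Term → Type → Set where
    ax   : ∀ {Γ x U} → Lookup Γ x U → Γ ⊢ var x ∶ unit U
    ax0  : ∀ {Γ} → Γ ⊢ 𝟎 ∶ 𝟘
    →E   : ∀ {Γ t r U} (α β : ℕ) (Ts : Fin α → Type) →
           Γ ⊢ t ∶ sumT α (λ i → unit (U ⇒ Ts i)) →
           Γ ⊢ r ∶ β · unit U →
           Γ ⊢ t $ r ∶ sumT α (λ i → β · Ts i)
    →I   : ∀ {Γ x U t T} → ((x , U) ∷ Γ) ⊢ t ∶ T → Γ ⊢ lam x U t ∶ unit (U ⇒ T)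
    ∀E   : ∀ {Γ t X U V} → Γ ⊢ t ∶ unit (∀' X U) → Γ ⊢ t ＠ V ∶ unit (U [ V / X ])
    ∀I   : ∀ {Γ t X U} → Γ ⊢ t ∶ unit U → ¬ (X ∈ fvCtx Γ) → Γ ⊢ Lam X t ∶ unit (∀' X U)
    +I   : ∀ {Γ t r T R} → Γ ⊢ t ∶ T → Γ ⊢ r ∶ R → Γ ⊢ t + r ∶ (T ⊕ R)
    sI   : ∀ {Γ t T} (α : Scalar) → Γ ⊢ t ∶ T → Γ ⊢ α ∙ t ∶ (⌊ α ⌋ · T)
    Eq   : ∀ {Γ t T R} → Γ ⊢ t ∶ T → T ≈ R → Γ ⊢ t ∶ R

module Submission where

-- A derivation of  Γ ⊢ t ∶ T  for a term t of a given syntactic form can only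
-- end in one of two rules: the unique introduction/elimination rule for that
-- form, or the conversion rule (Eq).

open import Defs
open import Data.Nat using (ℕ)
open import Data.Fin using (Fin)
open import Data.List using (_∷_)
open import Data.Product using (_×_; Σ; _,_)
open import Data.List.Membership.Propositional using (_∈_)
open import Relation.Nullary using (¬_)

module Inversion (Scalar : Set) (⌊_⌋ : Scalar → ℕ) where
  open λCA Scalar ⌊_⌋

  inv-app : ∀ {Γ T} (u v : Term) → Γ ⊢ u $ v ∶ T →
    Σ ℕ λ α → Σ ℕ λ β → Σ UType λ U → Σ (Fin α → Type) λ Ts →
      (Γ ⊢ u ∶ sumT α (λ i → unit (U ⇒ Ts i)))
      × (Γ ⊢ v ∶ β · unit U)
      × (sumT α (λ i → β · Ts i) ≈ T)
  inv-app u v (→E α β Ts ⊢u ⊢v) = α , β , _ , Ts , ⊢u , ⊢v , ≈-refl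
  inv-app u v (Eq ⊢uv T'≈T) with inv-app u v ⊢uv
  ... | α , β , U , Ts , ⊢u , ⊢v , eq = α , β , U , Ts , ⊢u , ⊢v , ≈-trans eq T'≈T

  inv-lam : ∀ {Γ T} (x : TmVar) (U : UType) (t : Term) → Γ ⊢ lam x U t ∶ T →
    Σ Type λ R → (((x , U) ∷ Γ) ⊢ t ∶ R) × (unit (U ⇒ R) ≈ T)
  inv-lam x U t (→I ⊢t) = _ , ⊢t , ≈-refl
  inv-lam x U t (Eq ⊢λ T'≈T) with inv-lam x U t ⊢λ
  ... | R , ⊢t , eq = R , ⊢t , ≈-trans eq T'≈T

  inv-sum : ∀ {Γ T} (u v : Term) → Γ ⊢ u + v ∶ T →
    Σ Type λ R → Σ Type λ S → (Γ ⊢ u ∶ R) × (Γ ⊢ v ∶ S) × ((R ⊕ S) ≈ T)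
  inv-sum u v (+I ⊢u ⊢v) = _ , _ , ⊢u , ⊢v , ≈-refl
  inv-sum u v (Eq ⊢u+v T'≈T) with inv-sum u v ⊢u+v
  ... | R , S , ⊢u , ⊢v , eq = R , S , ⊢u , ⊢v , ≈-trans eq T'≈T

  inv-scal : ∀ {Γ T} (α : Scalar) (u : Term) → Γ ⊢ α ∙ u ∶ T →
    Σ Type λ R → (Γ ⊢ u ∶ R) × ((⌊ α ⌋ · R) ≈ T)
  inv-scal α u (sI .α ⊢u) = _ , ⊢u , ≈-refl
  inv-scal α u (Eq ⊢αu T'≈T) with inv-scal α u ⊢αu
  ... | R , ⊢u , eq = R , ⊢u , ≈-trans eq T'≈T

  inv-Lam : ∀ {Γ T} (X : TyVar) (t : Term) → Γ ⊢ Lam X t ∶ T →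
    Σ UType λ R → (Γ ⊢ t ∶ unit R) × (unit (∀' X R) ≈ T) × ¬ (X ∈ fvCtx Γ)
  inv-Lam X t (∀I ⊢t X∉Γ) = _ , ⊢t , ≈-refl , X∉Γ
  inv-Lam X t (Eq ⊢Λ T'≈T) with inv-Lam X t ⊢Λ
  ... | R , ⊢t , eq , X∉Γ = R , ⊢t , ≈-trans eq T'≈T , X∉Γ

  inv-tapp : ∀ {Γ T} (t : Term) (U : UType) → Γ ⊢ t ＠ U ∶ T →
    Σ TyVar λ X → Σ UType λ V → (Γ ⊢ t ∶ unit (∀' X V)) × (unit (V [ U / X ]) ≈ T)
  inv-tapp t U (∀E ⊢t) = _ , _ , ⊢t , ≈-refl
  inv-tapp t U (Eq ⊢tU T'≈T) with inv-tapp t U ⊢tU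
  ... | X , V , ⊢t , eq = X , V , ⊢t , ≈-trans eq T'≈T

open Inversion

lemma1 : (Scalar : Set) (⌊_⌋ : Scalar → ℕ) →
    let open λCA Scalar ⌊_⌋ in
    (Γ : Ctx) (T : Type) →
      (∀ (u v : Term) → Γ ⊢ u $ v ∶ T →
        Σ ℕ λ α → Σ ℕ λ β → Σ UType λ U → Σ (Fin α → Type) λ Ts →
          (Γ ⊢ u ∶ sumT α (λ i → unit (U ⇒ Ts i)))
          × (Γ ⊢ v ∶ β · unit U)
          × (sumT α (λ i → β · Ts i) ≈ T))
    × (∀ (x : TmVar) (U : UType) (t : Term) → Γ ⊢ lam x U t ∶ T →
        Σ Type λ R → (((x , U) ∷ Γ) ⊢ t ∶ R) × (unit (U ⇒ R) ≈ T))
    × (∀ (u v : Term) → Γ ⊢ u + v ∶ T →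
        Σ Type λ R → Σ Type λ S → (Γ ⊢ u ∶ R) × (Γ ⊢ v ∶ S) × ((R ⊕ S) ≈ T))
    × (∀ (α : Scalar) (u : Term) → Γ ⊢ α ∙ u ∶ T →
        Σ Type λ R → (Γ ⊢ u ∶ R) × ((⌊ α ⌋ · R) ≈ T))
    × (∀ (X : TyVar) (t : Term) → Γ ⊢ Lam X t ∶ T →
        Σ UType λ R → (Γ ⊢ t ∶ unit R) × (unit (∀' X R) ≈ T) × ¬ (X ∈ fvCtx Γ))
    × (∀ (t : Term) (U : UType) → Γ ⊢ t ＠ U ∶ T →
        Σ TyVar λ X → Σ UType λ V → (Γ ⊢ t ∶ unit (∀' X V)) × (unit (V [ U / X ]) ≈ T))
lemma1 Scalar ⌊_⌋ Γ T =
    inv-app  Scalar ⌊_⌋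
  , inv-lam  Scalar ⌊_⌋
  , inv-sum  Scalar ⌊_⌋
  , inv-scal Scalar ⌊_⌋
  , inv-Lam  Scalar ⌊_⌋
  , inv-tapp Scalar ⌊_⌋
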